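{- For each $k\in\{1,2\}$, $W^b_k\subseteq W^d_k$.
   Context: Formulas are built from a countable set $PL$ of propositional letters and the constant $\bot$ using binary connectives $\land,\lor,\to$; $Form$ is the set of formulas; $\neg\alpha:=\alpha\to\bot$, $\top:=\bot\to\bot$; precedence $\neg>\land=\lor>\to$. Any $\vdash\subseteq Form\times Form$ is extended to sets: $\Gamma\vdash\alpha$ iff $\bigwedge\Gamma_0\vdash\alpha$ for some finite $\Gamma_0\subseteq\Gamma$ ($\bigwedge\emptyset=\top$); "$\vdash\alpha$" means $\chi\vdash\alpha$ for all $\chi$. Basic rules (all formulas, all $n\ge1$): (A) $\alpha\vdash\alpha$; (Cut) $\alpha\vdash\beta,\beta\vdash\gamma\Rightarrow\alpha\vdash\gamma$; ($\bot$) $\bot\vdash\alpha$; ($\land$R) $\chi\vdash\alpha,\chi\vdash\beta\Rightarrow\chi\vdash\alpha\land\beta$; ($\land$L) $\alpha\land\beta\vdash\alpha$, $\alpha\land\beta\vdash\beta$; ($\lor$R) $\alpha\vdash\alpha\lor\beta$, $\beta\vdash\alpha\lor\beta$; ($\lor$L) $\alpha\vdash\chi,\beta\vdash\chi\Rightarrow\alpha\lor\beta\vdash\chi$; (DT$_0$) $\alpha\vdash\beta\Rightarrow\ \vdash\alpha\to\beta$; ($\to\land$) $(\alpha\to\beta)\land(\alpha\to\gamma)\vdash\alpha\to\beta\land\gamma$; ($\to$tr) $(\alpha\to\beta)\land(\beta\to\gamma)\vdash\alpha\to\gamma$; ($\to$-$\lor$.s) $\bigvee_{j\le n}(\alpha_j\to\beta_j)\land\bigwedge_j(\psi_j\land\beta_j\to\chi)\vdash\bigwedge_j(\psi_j\land\alpha_j)\to\chi$.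 Further: (Abs) $\alpha\land\neg\alpha\vdash\bot$; ($\neg\neg$I) $\alpha\vdash\neg\neg\alpha$; (Refl$_1$) if $\psi_j\land\beta_j\vdash\chi$ for all $j\le n$ then $\bigwedge_j(\psi_j\land\alpha_j)\land\bigvee_j(\alpha_j\to\beta_j)\vdash\chi$; (Refl$_2$) $\bigwedge_{j\le n}(\psi_j\land\beta_j\to\chi)\vdash\bigwedge_j(\psi_j\land\alpha_j)\land\bigvee_j(\alpha_j\to\beta_j)\to\chi$. i-formulas: $\Delta\sqsupset\Theta$ with $\Delta,\Theta$ nonempty finite subsets of $Form$. $\Vdash_1$ is the least relation between sets of i-formulas and i-formulas satisfying: (A) $\Gamma^i\cup\{\alpha^i\}\Vdash\alpha^i$; (Cut) $\Gamma^i\Vdash\alpha^i,\ \Phi^i\cup\{\alpha^i\}\Vdash\beta^i\Rightarrow\Gamma^i\cup\Phi^i\Vdash\beta^i$; (i-A) $\Delta\cap\Theta\ne\emptyset\Rightarrow\emptyset\Vdash\Delta\sqsupset\Theta$; (i-Cut) $\{\Delta_1\sqsupset\Theta_1\cup\{\varphi\},\Delta_2\cup\{\varphi\}\sqsupset\Theta_2\}\Vdash\Delta_1\cup\Delta_2\sqsupset\Theta_1\cup\Theta_2$; (i-$\land$L) $\emptyset\Vdash\{\varphi\land\psi\}\sqsupset\{\varphi\}$, $\emptyset\Vdash\{\varphi\land\psi\}\sqsupset\{\psi\}$; (i-$\land$R) $\emptyset\Vdash\{\varphi,\psi\}\sqsupset\{\varphi\land\psi\}$. $\Vdash_2^\gamma$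 additionally satisfies ($\gamma$-Refl) $\emptyset\Vdash\{\varphi_1,\dots,\varphi_n,\bigvee_j(\varphi_j\to\psi_j)\lor\gamma\}\sqsupset\{\psi_1,\dots,\psi_n\}$. $i_\gamma(\Gamma)=\{\{\varphi_1..\varphi_n\}\sqsupset\{\psi_1..\psi_n\}\mid n\ge1,\bigvee_j(\varphi_j\to\psi_j)\lor\gamma\in\Gamma\}$; $Th_\vdash(\Gamma)=\{\alpha\mid\Gamma\vdash\alpha\}$. (Prop$_1$): if $i_\gamma(Th_\vdash(\alpha))\Vdash_1\{\top\}\sqsupset\{\bot\}$ then $\alpha\vdash\gamma$; (Prop$_2$): same with $\Vdash_2^\gamma$. $\vdash_1$ is the smallest relation satisfying the basic rules, (Abs), ($\neg\neg$I), (Prop$_1$); $\vdash_2$ the smallest satisfying the basic rules, ($\neg\neg$I), (Refl$_1$), (Refl$_2$), (Prop$_2$). Canonical sets. $\Gamma$ is $\vdash$-closed iff $Th_\vdash(\Gamma)\subseteq\Gamma$; $\Delta$ is $\vdash$-downward closed iff $\beta\in\Delta$ and $\alpha\vdash\beta$ imply $\alpha\in\Delta$; $\neg(\Gamma)=\{\neg\alpha\mid\alpha\in\Gamma\}$; $\to\!(\Gamma)=\{\alpha\to\beta\mid\alpha\in\Gamma,\beta\notin\Gamma\}$. $W^d_1$ is the set of pairs $\langle\Gamma,\Delta\rangle$ of sets of formulas with $\Gamma$ $\vdash_1$-closed, $\{\bot\}\cup\neg(\Gamma)\cup\to\!(\Gamma)\subseteq\Delta$, and $\Delta$ $\vdash_1$-downward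 closed and closed under disjunction; $W^d_2$ is defined likewise with $\vdash_2$ and the extra condition $\Gamma\cap\Delta=\emptyset$. For $\gamma\in Form$, $\Gamma\subseteq Form$: $I^\gamma_k(\Gamma)=\{\varphi\mid\exists n\ge1,\ \alpha_1,\dots,\alpha_n\in\Gamma,\ \beta_1,\dots,\beta_n\notin\Gamma$ with $\varphi\vdash_k(\alpha_1\to\beta_1)\lor\dots\lor(\alpha_n\to\beta_n)\lor\gamma\}$. $W^b_1=\{\langle\Gamma,I^\gamma_1(\Gamma)\rangle\mid\gamma\in Form,\ \Gamma\ \vdash_1\text{ -closed},\ \bot\notin\Gamma\}$; $W^b_2=\{\langle\Gamma,I^\gamma_2(\Gamma)\rangle\mid\gamma\in Form,\ \Gamma\ \vdash_2\text{ -closed},\ \bot\notin\Gamma,\ \Gamma\cap I^\gamma_2(\Gamma)=\emptyset\}$. -}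

module Defs where

open import Data.Nat using (ℕ; zero; suc)
open import Data.Fin using (Fin; zero; suc)
open import Data.List using (List; []; _∷_; tabulate)
open import Data.List.NonEmpty using (List⁺; _∷_; toList; _⁺++_; _++⁺_)
open import Data.List.Membership.Propositional using (_∈_)
open import Data.List.Relation.Unary.All using (All)
open import Data.Product using (Σ; _×_; _,_)
open import Data.Empty using (⊥)
open import Data.Unit using () renaming (⊤ to ⊤ᵤ)
open import Relation.Binary.PropositionalEquality using (_≡_)
open import Function using (_∘_)

infixr 6 _⇒_
infixl 7 _∧_ _∨_

data Form : Set where
  var  : ℕ → Form
  ⊥'   : Form
  _∧_  : Form → Form → Form
  _∨_  : Form → Form → Form
  _⇒_  : Form → Form → Form

¬' : Form → Form
¬' α = α ⇒ ⊥'

⊤' : Form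
⊤' = ⊥' ⇒ ⊥'

-- Big conjunction / disjunction over j ≤ n, n ≥ 1 (indices Fin (suc n)),
-- right-associated.
⋀ : ∀ n → (Fin (suc n) → Form) → Form
⋀ zero    f = f zero
⋀ (suc n) f = f zero ∧ ⋀ n (f ∘ suc)

⋁ : ∀ n → (Fin (suc n) → Form) → Form
⋁ zero    f = f zero
⋁ (suc n) f = f zero ∨ ⋁ n (f ∘ suc)

⋀L : List Form → Form
⋀L []           = ⊤'
⋀L (x ∷ [])     = x
⋀L (x ∷ y ∷ xs) = x ∧ ⋀L (y ∷ xs)

-- i-formulas Δ ⊐ Θ, Δ Θ nonempty finite sets (as nonempty lists, read
-- up to set equality, see the 'ext' rule below).

record IForm : Set where
  constructor _⊐_
  field
    lhs : List⁺ Form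
    rhs : List⁺ Form
open IForm public

_⊆L_ : List⁺ Form → List⁺ Form → Set
A ⊆L B = ∀ {x} → x ∈ toList A → x ∈ toList B

_≈ᵢ_ : IForm → IForm → Set
(Δ ⊐ Θ) ≈ᵢ (Δ' ⊐ Θ') = (Δ ⊆L Δ') × (Δ' ⊆L Δ) × (Θ ⊆L Θ') × (Θ' ⊆L Θ)

[_] : Form → List⁺ Form
[ x ] = x ∷ []

fset : ∀ n → (Fin (suc n) → Form) → List⁺ Form
fset n f = f zero ∷ tabulate (f ∘ suc)

reflForm : ∀ n → (Fin (suc n) → Form) → (Fin (suc n) → Form) → Form → Form
reflForm n φ ψ γ = ⋁ n (λ j → φ j ⇒ ψ j) ∨ γ

data Mode : Set where
  mode1 : Mode
  mode2 : Form → Mode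

-- H ⊩[ m ] i : the i-formula i is derivable from the set H of i-formulas.
-- (A) is 'hyp'; (Cut) is admissible for this presentation.
data _⊩[_]_ (H : IForm → Set) : Mode → IForm → Set where
  hyp    : ∀ {m i} → H i → H ⊩[ m ] i
  ext    : ∀ {m i j} → H ⊩[ m ] i → i ≈ᵢ j → H ⊩[ m ] j
  i-A    : ∀ {m Δ Θ φ} → φ ∈ toList Δ → φ ∈ toList Θ → H ⊩[ m ] (Δ ⊐ Θ)
  i-Cut  : ∀ {m Δ₁ Θ₁ Δ₂ Θ₂ φ} →
           H ⊩[ m ] (Δ₁ ⊐ (φ ∷ Θ₁)) → H ⊩[ m ] ((φ ∷ Δ₂) ⊐ Θ₂) →
           H ⊩[ m ] ((Δ₁ ⁺++ Δ₂) ⊐ (Θ₁ ++⁺ Θ₂))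
  i-∧L₁  : ∀ {m φ ψ} → H ⊩[ m ] ([ φ ∧ ψ ] ⊐ [ φ ])
  i-∧L₂  : ∀ {m φ ψ} → H ⊩[ m ] ([ φ ∧ ψ ] ⊐ [ ψ ])
  i-∧R   : ∀ {m φ ψ} → H ⊩[ m ] ((φ ∷ ψ ∷ []) ⊐ [ φ ∧ ψ ])
  γ-Refl : ∀ {γ} n (φ ψ : Fin (suc n) → Form) →
           H ⊩[ mode2 γ ] ((reflForm n φ ψ γ ∷ toList (fset n φ)) ⊐ fset n ψ)

iγ : Form → (Form → Set) → IForm → Set
iγ γ Γ i = Σ ℕ λ n → Σ (Fin (suc n) → Form) λ φ → Σ (Fin (suc n) → Form) λ ψ →
           (i ≡ (fset n φ ⊐ fset n ψ)) × Γ (reflForm n φ ψ γ)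

data K : Set where
  k1 k2 : K

modeOf : K → Form → Mode
modeOf k1 γ = mode1
modeOf k2 γ = mode2 γ

data Der : K → Form → Form → Set where
  ax    : ∀ {k α} → Der k α α
  cut   : ∀ {k α β γ} → Der k α β → Der k β γ → Der k α γ
  ⊥L    : ∀ {k α} → Der k ⊥' α
  ∧R    : ∀ {k χ α β} → Der k χ α → Der k χ β → Der k χ (α ∧ β)
  ∧L₁   : ∀ {k α β} → Der k (α ∧ β) α
  ∧L₂   : ∀ {k α β} → Der k (α ∧ β) β
  ∨R₁   : ∀ {k α β} → Der k α (α ∨ β)
  ∨R₂   : ∀ {k α β} → Der k β (α ∨ β)
  ∨L    : ∀ {k α β χ} → Der k α χ → Der k β χ → Der k (α ∨ β) χ
  DT₀   : ∀ {k α β χ} → Der k α β → Der k χ (α ⇒ β)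
  ⇒∧    : ∀ {k α β γ} → Der k ((α ⇒ β) ∧ (α ⇒ γ)) (α ⇒ β ∧ γ)
  ⇒tr   : ∀ {k α β γ} → Der k ((α ⇒ β) ∧ (β ⇒ γ)) (α ⇒ γ)
  ⇒∨s   : ∀ {k} n (α β ψ : Fin (suc n) → Form) (χ : Form) →
          Der k (⋁ n (λ j → α j ⇒ β j) ∧ ⋀ n (λ j → ψ j ∧ β j ⇒ χ))
                (⋀ n (λ j → ψ j ∧ α j) ⇒ χ)
  ¬¬I   : ∀ {k α} → Der k α (¬' (¬' α))
  Abs   : ∀ {α} → Der k1 (α ∧ ¬' α) ⊥'
  Refl₁ : ∀ n (α β ψ : Fin (suc n) → Form) (χ : Form) →
          (∀ j → Der k2 (ψ j ∧ β j) χ) →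
          Der k2 (⋀ n (λ j → ψ j ∧ α j) ∧ ⋁ n (λ j → α j ⇒ β j)) χ
  Refl₂ : ∀ n (α β ψ : Fin (suc n) → Form) (χ : Form) →
          Der k2 (⋀ n (λ j → ψ j ∧ β j ⇒ χ))
                 (⋀ n (λ j → ψ j ∧ α j) ∧ ⋁ n (λ j → α j ⇒ β j) ⇒ χ)
  Prop  : ∀ {k α γ} → iγ γ (Der k α) ⊩[ modeOf k γ ] ([ ⊤' ] ⊐ [ ⊥' ]) → Der k α γ

_⊢[_]_ : (Form → Set) → K → Form → Set
Γ ⊢[ k ] α = Σ (List Form) λ Γ₀ → All Γ Γ₀ × Der k (⋀L Γ₀) α

Closed : K → (Form → Set) → Set
Closed k Γ = ∀ α → Γ ⊢[ k ] α → Γ α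

DownClosed : K → (Form → Set) → Set
DownClosed k Δ = ∀ α β → Δ β → Der k α β → Δ α

DisjClosed : (Form → Set) → Set
DisjClosed Δ = ∀ α β → Δ α → Δ β → Δ (α ∨ β)

Contains : (Form → Set) → (Form → Set) → Set
Contains Γ Δ = Δ ⊥' × (∀ α → Γ α → Δ (¬' α))
                    × (∀ α β → Γ α → (Γ β → ⊥) → Δ (α ⇒ β))

Disjoint : (Form → Set) → (Form → Set) → Set
Disjoint Γ Δ = ∀ α → Γ α → Δ α → ⊥

Extra : K → (Form → Set) → (Form → Set) → Set
Extra k1 Γ Δ = ⊤ᵤ
Extra k2 Γ Δ = Disjoint Γ Δ

Wd : K → (Form → Set) → (Form → Set) → Set
Wd k Γ Δ = Closed k Γ × Contains Γ Δ × DownClosed k Δ × DisjClosed Δ × Extra k Γ Δ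

I : K → Form → (Form → Set) → Form → Set
I k γ Γ φ = Σ ℕ λ n → Σ (Fin (suc n) → Form) λ α → Σ (Fin (suc n) → Form) λ β →
            (∀ j → Γ (α j)) × (∀ j → Γ (β j) → ⊥) × Der k φ (reflForm n α β γ)

-- side conditions on (γ, Γ) for ⟨Γ , I^γ_k(Γ)⟩ ∈ W^b_k
WbCond : K → Form → (Form → Set) → Set
WbCond k γ Γ = Closed k Γ × (Γ ⊥' → ⊥) × Extra k Γ (I k γ Γ)

{-# OPTIONS --safe #-}
module Submission where

-- Downward closure is Cut; closure under ∨ concatenates the two families
-- of implications; a single α → β with α ∈ Γ, β ∉ Γ lies in I by ∨R, which gives ¬(Γ)
-- (as ⊥ ∉ Γ) and ⊥ (as ⊥ ⊢ ⊤ → ⊥ with ⊤ ∈ Γ).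

open import Defs
open import Data.Nat using (zero; suc; _+_)
open import Data.Fin using (Fin; zero; suc; _↑ˡ_; _↑ʳ_)
open import Data.List using ([])
open import Data.List.Relation.Unary.All using ([])
open import Data.Product using (_,_)
open import Data.Vec.Functional using (_++_)
open import Data.Vec.Functional.Properties using (lookup-++ˡ; lookup-++ʳ)
open import Data.Vec.Functional.Relation.Unary.All.Properties using (++⁺)
open import Relation.Nullary using (¬_)
open import Relation.Unary using (∁)
open import Relation.Binary.PropositionalEquality using (_≡_; subst; cong₂)
open import Function using (_∘_)

private
  variable
    k : K
    γ : Form

⋁R : ∀ n (F : Fin (suc n) → Form) j → Der k (F j) (⋁ n F)
⋁R zero    F zero    = ax
⋁R (suc n) F zero    = ∨R₁
⋁R (suc n) F (suc j) = cut (⋁R n (F ∘ suc) j) ∨R₂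

⋁L : ∀ n (F : Fin (suc n) → Form) {χ} → (∀ j → Der k (F j) χ) → Der k (⋁ n F) χ
⋁L zero    F d = d zero
⋁L (suc n) F d = ∨L (d zero) (⋁L n (F ∘ suc) (d ∘ suc))

reflForm-reindex : ∀ {n N} {α β : Fin (suc n) → Form} {α′ β′ : Fin (suc N) → Form}
                   (σ : Fin (suc n) → Fin (suc N)) →
                   (∀ i → α′ (σ i) ≡ α i) → (∀ i → β′ (σ i) ≡ β i) →
                   Der k (reflForm n α β γ) (reflForm N α′ β′ γ)
reflForm-reindex {k = k} {n = n} {N} {α′ = α′} {β′} σ α′∘σ≡α β′∘σ≡β =
  ∨L (cut (⋁L n _ λ i → subst (λ φ → Der k φ (⋁ N F)) (cong₂ _⇒_ (α′∘σ≡α i) (β′∘σ≡β i))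
                                (⋁R N F (σ i)))
          ∨R₁)
     ∨R₂
  where
  F : Fin (suc N) → Form
  F j = α′ j ⇒ β′ j

reflForm-∨ : ∀ n m (α β : Fin (suc n) → Form) (α′ β′ : Fin (suc m) → Form) →
             Der k (reflForm n α β γ ∨ reflForm m α′ β′ γ)
                   (reflForm (n + suc m) (α ++ α′) (β ++ β′) γ)
reflForm-∨ n m α β α′ β′ =
  ∨L (reflForm-reindex (_↑ˡ suc m) (lookup-++ˡ α α′) (lookup-++ˡ β β′))
     (reflForm-reindex (suc n ↑ʳ_) (lookup-++ʳ α α′) (lookup-++ʳ β β′))

module _ (Γ : Form → Set) where

  I-downClosed : DownClosed k (I k γ Γ)
  I-downClosed φ ψ (n , α , β , α∈Γ , β∉Γ , ψ⊢refl) φ⊢ψ =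
    n , α , β , α∈Γ , β∉Γ , cut φ⊢ψ ψ⊢refl

  I-disjClosed : DisjClosed (I k γ Γ)
  I-disjClosed φ ψ (n , α , β , α∈Γ , β∉Γ , φ⊢refl) (m , α′ , β′ , α′∈Γ , β′∉Γ , ψ⊢refl) =
    n + suc m , α ++ α′ , β ++ β′ , ++⁺ Γ α∈Γ α′∈Γ , ++⁺ (∁ Γ) β∉Γ β′∉Γ ,
    cut (∨L (cut φ⊢refl ∨R₁) (cut ψ⊢refl ∨R₂)) (reflForm-∨ n m α β α′ β′)

  ⇒∈I : ∀ {α β} → Γ α → ¬ Γ β → I k γ Γ (α ⇒ β)
  ⇒∈I α∈Γ β∉Γ = zero , (λ _ → _) , (λ _ → _) , (λ _ → α∈Γ) , (λ _ → β∉Γ) , ∨R₁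

  ⊤∈closed : Closed k Γ → Γ ⊤'
  ⊤∈closed closed = closed ⊤' ([] , [] , ax)

  I-contains : Closed k Γ → ¬ Γ ⊥' → Contains Γ (I k γ Γ)
  I-contains closed ⊥∉Γ =
    I-downClosed ⊥' (⊤' ⇒ ⊥') (⇒∈I (⊤∈closed closed) ⊥∉Γ) ⊥L ,
    (λ α α∈Γ → ⇒∈I α∈Γ ⊥∉Γ) ,
    (λ α β → ⇒∈I)

lemma13 : ∀ (k : K) (γ : Form) (Γ : Form → Set) → WbCond k γ Γ → Wd k Γ (I k γ Γ)
lemma13 k γ Γ (closed , ⊥∉Γ , extra) =
  closed , I-contains Γ closed ⊥∉Γ , I-downClosed Γ , I-disjClosed Γ , extra
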